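{- For every integer $j\ge0$, the following identity of formal power series holds in $\mathbb{Q}[[t]]$: \[\left(\frac{t}{e^t-1}\right)^{j+1}h_j(e^t-1)=j!\left(1+(-1)^j\sum_{n\ge j+1}\binom{n-1}{j}\frac{B_nt^n}{n!}\right),\] where $B_n$ is the $n$-th Bernoulli number.
   Context: The polynomials $h_j(X)$ are defined by $h_0(X)=1$ and $h_j(X)=(1+X)\left(-X\frac{d}{dX}+j\right)h_{j-1}(X)$ for $j\ge1$. Bernoulli numbers are defined by $\frac{t}{e^t-1}=\sum_{n\ge0}B_nt^n/n!$. -}

module Defs where

open import Data.Nat as ℕ using (ℕ; zero; suc; _∸_; _<_; _<?_; _!)
open import Data.Nat.Properties using (_!≢0)
open import Data.Nat.Combinatorics using (_C_)
open import Data.Integer using (+_)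
open import Data.Rational using (ℚ; 0ℚ; 1ℚ; _+_; _*_; _-_; -_; _/_)
open import Data.List using (List; []; _∷_)
open import Relation.Nullary using (yes; no)
open import Relation.Binary.PropositionalEquality using (_≡_)

ℕ→ℚ : ℕ → ℚ
ℕ→ℚ n = + n / 1

inv! : ℕ → ℚ
inv! n = (+ 1 / (n !)) {{n !≢0}}

neg1^ : ℕ → ℚ
neg1^ zero    = 1ℚ
neg1^ (suc j) = - neg1^ j

-- Formal power series over ℚ: coefficient sequences  f n = [t^n] f

PS : Set
PS = ℕ → ℚ

sumTo : ℕ → (ℕ → ℚ) → ℚ
sumTo zero    f = f zero
sumTo (suc n) f = sumTo n f + f (suc n)

_≈ₚ_ : PS → PS → Set
f ≈ₚ g = ∀ n → f n ≡ g n

constP : ℚ → PS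
constP a zero    = a
constP a (suc n) = 0ℚ

zeroP oneP tP : PS
zeroP _ = 0ℚ
oneP = constP 1ℚ
tP zero          = 0ℚ
tP (suc zero)    = 1ℚ
tP (suc (suc n)) = 0ℚ

_+ₚ_ : PS → PS → PS
(f +ₚ g) n = f n + g n

_*ₚ_ : PS → PS → PS
(f *ₚ g) n = sumTo n (λ k → f k * g (n ∸ k))

_^ₚ_ : PS → ℕ → PS
f ^ₚ zero  = oneP
f ^ₚ suc m = f *ₚ (f ^ₚ m)

expm1 : PS
expm1 zero    = 0ℚ
expm1 (suc n) = inv! (suc n)

-- Polynomials over ℚ as coefficient lists [a₀, a₁, …] (a₀ + a₁ X + …)

Poly : Set
Poly = List ℚ

_+ₗ_ : Poly → Poly → Poly
[]       +ₗ q        = q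
(a ∷ p)  +ₗ []       = a ∷ p
(a ∷ p)  +ₗ (b ∷ q)  = (a + b) ∷ (p +ₗ q)

onePlusX· : Poly → Poly
onePlusX· p = p +ₗ (0ℚ ∷ p)

-- (-X d/dX + c) applied to Σ_{k≥i} a_k X^k, where c is the current
-- scalar c₀ - i: coefficient a_k becomes (c₀ - k) a_k
shiftOp : ℚ → Poly → Poly
shiftOp c []      = []
shiftOp c (a ∷ p) = (c * a) ∷ shiftOp (c - 1ℚ) p

thetaOp : ℕ → Poly → Poly
thetaOp j p = shiftOp (ℕ→ℚ j) p

-- h_0 = 1,  h_j = (1+X)(-X d/dX + j) h_{j-1}
h : ℕ → Poly
h zero    = 1ℚ ∷ []
h (suc j) = onePlusX· (thetaOp (suc j) (h j))

evalP : Poly → PS → PS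
evalP []      F = zeroP
evalP (a ∷ p) F = constP a +ₚ (F *ₚ evalP p F)

-- Bernoulli numbers: B is the Bernoulli sequence iff
--   (Σ_n B_n t^n / n!) · (e^t - 1) = t ,  i.e.  t/(e^t-1) = Σ B_n t^n/n!
-- (this determines B uniquely since e^t - 1 = t · unit).

egf : (ℕ → ℚ) → PS
egf B n = B n * inv! n

IsBernoulli : (ℕ → ℚ) → Set
IsBernoulli B = (egf B *ₚ expm1) ≈ₚ tP

rhs : (ℕ → ℚ) → ℕ → PS
rhs B j n = ℕ→ℚ (j !) * (oneP n + neg1^ j * tailTerm n)
  where
  tailTerm : ℕ → ℚ
  tailTerm n with j <? n
  ... | yes _ = ℕ→ℚ ((n ∸ 1) C j) * B n * inv! n
  ... | no  _ = 0ℚ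

lhs : (ℕ → ℚ) → ℕ → PS
lhs B j = (egf B ^ₚ suc j) *ₚ evalP (h j) expm1

{-# OPTIONS --safe #-}
-- Write θ = t d/dt, F = eᵗ − 1 and β = t/(eᵗ − 1), and put L_j = β^{j+1} h_j(F).
-- Since θF = t eᵗ and βF = t, β satisfies θβ = β − eᵗβ², and the recursion defining
-- h_j turns into L_{j+1} = (j + 1 − θ) L_j.  Hence L_j = ∏_{i=1}^{j} (i − θ) β, whose
-- coefficient of tⁿ is ∏_{i=1}^{j} (i − n) · B_n/n!: this is j! for n = 0 (B_0 = 1) and
-- (−1)^j j! C(n−1, j) B_n/n! for n ≥ 1, which vanishes when n ≤ j.
module Submission where

open import Defs
open import Level using (0ℓ)
open import Function using (_∘_)
open import Data.Nat as ℕ using (ℕ; zero; suc; _∸_; _≤_; z≤n; _!; _<?_)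
import Data.Nat.Properties as ℕP
import Data.Nat.Solver as ℕSolver
open import Data.Nat.Combinatorics using (_C_; k>n⇒nCk≡0; nCk+nC[k+1]≡[n+1]C[k+1]; nC1≡n)
import Data.Integer as ℤ
import Data.Integer.Properties as ℤP
open import Data.Rational as ℚ using (ℚ; 0ℚ; 1ℚ; _+_; _*_; _-_; -_; _/_; mkℚ)
import Data.Rational.Properties as ℚP
import Data.Rational.Solver as ℚSolver
open import Data.Rational.Unnormalised using (mkℚᵘ; *≡*)
import Data.Nat.Coprimality as Coprimality
open import Data.List using ([]; _∷_)
open import Data.Product using (_,_)
open import Data.Maybe using (Maybe; nothing; just)
open import Relation.Nullary using (yes; no)
open import Relation.Binary.PropositionalEquality using (_≡_; refl; sym; trans; cong; cong₂; module ≡-Reasoning)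
open import Relation.Binary.Structures using (IsEquivalence)
open import Algebra.Bundles using (CommutativeRing)
open import Algebra.Structures using (IsCommutativeRing)
import Algebra.Solver.Ring.AlmostCommutativeRing as ACR
import Algebra.Solver.Ring
import Relation.Binary.Reasoning.Setoid

ℕ→ℚ≡mkℚ : ∀ n → ℕ→ℚ n ≡ mkℚ (ℤ.+ n) 0 (Coprimality.sym (Coprimality.1-coprimeTo n))
ℕ→ℚ≡mkℚ n = ℚP.normalize-coprime (Coprimality.sym (Coprimality.1-coprimeTo n))

ℕ→ℚ-+ : ∀ m n → ℕ→ℚ (m ℕ.+ n) ≡ ℕ→ℚ m + ℕ→ℚ n
ℕ→ℚ-+ m n rewrite ℕ→ℚ≡mkℚ m | ℕ→ℚ≡mkℚ n =
  cong (_/ 1) (sym (cong₂ ℤ._+_ (ℤP.*-identityʳ (ℤ.+ m)) (ℤP.*-identityʳ (ℤ.+ n))))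

ℕ→ℚ-* : ∀ m n → ℕ→ℚ (m ℕ.* n) ≡ ℕ→ℚ m * ℕ→ℚ n
ℕ→ℚ-* m n rewrite ℕ→ℚ≡mkℚ m | ℕ→ℚ≡mkℚ n = cong (_/ 1) (ℤP.pos-* m n)

ℕ→ℚ-suc : ∀ n → ℕ→ℚ (suc n) ≡ 1ℚ + ℕ→ℚ n
ℕ→ℚ-suc = ℕ→ℚ-+ 1

1/d*d≡1 : ∀ d .{{_ : ℕ.NonZero d}} → (ℤ.+ 1 / d) * ℕ→ℚ d ≡ 1ℚ
1/d*d≡1 (suc d) rewrite ℕ→ℚ≡mkℚ (suc d) | ℚP.normalize-coprime {1} {d} (Coprimality.1-coprimeTo (suc d)) =
  trans (ℚP./-cong {p₂ = ℤ.+ suc d} {q₂ = suc d} (ℤP.*-identityˡ (ℤ.+ suc d)) (ℕP.*-identityʳ (suc d)))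
        (ℚP.fromℚᵘ-cong {mkℚᵘ (ℤ.+ suc d) d} {mkℚᵘ (ℤ.+ 1) 0} (*≡* (ℤP.*-comm (ℤ.+ suc d) (ℤ.+ 1))))

inv!*n!≡1 : ∀ n → inv! n * ℕ→ℚ (n !) ≡ 1ℚ
inv!*n!≡1 n = 1/d*d≡1 (n !) {{n ℕP.!≢0}}

inv!-suc : ∀ n → ℕ→ℚ (suc n) * inv! (suc n) ≡ inv! n
inv!-suc n = begin
  s * i               ≡⟨ sym (ℚP.*-identityʳ (s * i)) ⟩
  (s * i) * 1ℚ        ≡⟨ cong ((s * i) *_) (sym (inv!*n!≡1 n)) ⟩
  (s * i) * (j * f)   ≡⟨ solve 4 (λ s i j f → (s :* i) :* (j :* f) := (i :* (s :* f)) :* j) refl s i j f ⟩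
  (i * (s * f)) * j   ≡⟨ cong (λ z → (i * z) * j) (sym (ℕ→ℚ-* (suc n) (n !))) ⟩
  (i * ℕ→ℚ (suc n !)) * j ≡⟨ cong (_* j) (inv!*n!≡1 (suc n)) ⟩
  1ℚ * j              ≡⟨ ℚP.*-identityˡ j ⟩
  j                   ∎
  where
  open ≡-Reasoning
  open ℚSolver.+-*-Solver
  s = ℕ→ℚ (suc n)
  i = inv! (suc n)
  j = inv! n
  f = ℕ→ℚ (n !)

sumTo-cong≤ : ∀ n {f g : ℕ → ℚ} → (∀ k → k ≤ n → f k ≡ g k) → sumTo n f ≡ sumTo n g
sumTo-cong≤ zero    e = e 0 z≤n
sumTo-cong≤ (suc n) e =
  cong₂ _+_ (sumTo-cong≤ n (λ k k≤n → e k (ℕP.m≤n⇒m≤1+n k≤n))) (e (suc n) ℕP.≤-refl)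

sumTo-cong : ∀ n {f g : ℕ → ℚ} → (∀ k → f k ≡ g k) → sumTo n f ≡ sumTo n g
sumTo-cong n e = sumTo-cong≤ n (λ k _ → e k)

sumTo-zero : ∀ n → sumTo n (λ _ → 0ℚ) ≡ 0ℚ
sumTo-zero zero    = refl
sumTo-zero (suc n) = cong (_+ 0ℚ) (sumTo-zero n)

sumTo-+ : ∀ n (f g : ℕ → ℚ) → sumTo n (λ k → f k + g k) ≡ sumTo n f + sumTo n g
sumTo-+ zero    f g = refl
sumTo-+ (suc n) f g = begin
  sumTo n (λ k → f k + g k) + (f (suc n) + g (suc n))
    ≡⟨ cong (_+ (f (suc n) + g (suc n))) (sumTo-+ n f g) ⟩
  (sumTo n f + sumTo n g) + (f (suc n) + g (suc n))
    ≡⟨ solve 4 (λ a b c d → (a :+ b) :+ (c :+ d) := (a :+ c) :+ (b :+ d)) refl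
         (sumTo n f) (sumTo n g) (f (suc n)) (g (suc n)) ⟩
  (sumTo n f + f (suc n)) + (sumTo n g + g (suc n)) ∎
  where open ≡-Reasoning
        open ℚSolver.+-*-Solver

sumTo-*ˡ : ∀ n c (f : ℕ → ℚ) → sumTo n (λ k → c * f k) ≡ c * sumTo n f
sumTo-*ˡ zero    c f = refl
sumTo-*ˡ (suc n) c f = trans (cong (_+ c * f (suc n)) (sumTo-*ˡ n c f))
                             (sym (ℚP.*-distribˡ-+ c (sumTo n f) (f (suc n))))

sumTo-unfoldˡ : ∀ n (f : ℕ → ℚ) → sumTo (suc n) f ≡ f 0 + sumTo n (f ∘ suc)
sumTo-unfoldˡ zero    f = refl
sumTo-unfoldˡ (suc n) f =
  trans (cong (_+ f (suc (suc n))) (sumTo-unfoldˡ n f)) (ℚP.+-assoc (f 0) _ _)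

sumTo-reverse : ∀ n (f : ℕ → ℚ) → sumTo n (λ k → f (n ∸ k)) ≡ sumTo n f
sumTo-reverse zero    f = refl
sumTo-reverse (suc n) f = begin
  sumTo n (λ k → f (suc n ∸ k)) + f (n ∸ n)
    ≡⟨ cong₂ _+_ (sumTo-cong≤ n (λ k k≤n → cong f (ℕP.+-∸-assoc 1 k≤n))) (cong f (ℕP.n∸n≡0 n)) ⟩
  sumTo n (λ k → f (suc (n ∸ k))) + f 0
    ≡⟨ cong (_+ f 0) (sumTo-reverse n (f ∘ suc)) ⟩
  sumTo n (f ∘ suc) + f 0
    ≡⟨ ℚP.+-comm _ (f 0) ⟩
  f 0 + sumTo n (f ∘ suc)
    ≡⟨ sym (sumTo-unfoldˡ n f) ⟩
  sumTo (suc n) f ∎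
  where open ≡-Reasoning

tailₚ : PS → PS
tailₚ f n = f (suc n)

-ₚ_ : PS → PS
(-ₚ f) n = - f n

*ₚ-suc : ∀ f g n → (f *ₚ g) (suc n) ≡ f 0 * g (suc n) + (tailₚ f *ₚ g) n
*ₚ-suc f g n = sumTo-unfoldˡ n (λ k → f k * g (suc n ∸ k))

*ₚ-cong : ∀ {f f′ g g′} → f ≈ₚ f′ → g ≈ₚ g′ → (f *ₚ g) ≈ₚ (f′ *ₚ g′)
*ₚ-cong ef eg n = sumTo-cong n (λ k → cong₂ _*_ (ef k) (eg (n ∸ k)))

+ₚ-cong : ∀ {f f′ g g′} → f ≈ₚ f′ → g ≈ₚ g′ → (f +ₚ g) ≈ₚ (f′ +ₚ g′)
+ₚ-cong ef eg n = cong₂ _+_ (ef n) (eg n)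

+ₚ-congˡ : ∀ f {g g′} → g ≈ₚ g′ → (f +ₚ g) ≈ₚ (f +ₚ g′)
+ₚ-congˡ f e n = cong (f n +_) (e n)

+ₚ-congʳ : ∀ g {f f′} → f ≈ₚ f′ → (f +ₚ g) ≈ₚ (f′ +ₚ g)
+ₚ-congʳ g e n = cong (_+ g n) (e n)

*ₚ-congˡ : ∀ f {g g′} → g ≈ₚ g′ → (f *ₚ g) ≈ₚ (f *ₚ g′)
*ₚ-congˡ f = *ₚ-cong {f} {f} (λ _ → refl)

*ₚ-congʳ : ∀ g {f f′} → f ≈ₚ f′ → (f *ₚ g) ≈ₚ (f′ *ₚ g)
*ₚ-congʳ g e = *ₚ-cong {g = g} {g} e (λ _ → refl)

-ₚ-cong : ∀ {f f′} → f ≈ₚ f′ → (-ₚ f) ≈ₚ (-ₚ f′)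
-ₚ-cong e n = cong -_ (e n)

*ₚ-comm : ∀ f g → (f *ₚ g) ≈ₚ (g *ₚ f)
*ₚ-comm f g n = begin
  sumTo n (λ k → f k * g (n ∸ k))
    ≡⟨ sym (sumTo-reverse n _) ⟩
  sumTo n (λ k → f (n ∸ k) * g (n ∸ (n ∸ k)))
    ≡⟨ sumTo-cong≤ n (λ k k≤n → trans (cong (λ i → f (n ∸ k) * g i) (ℕP.m∸[m∸n]≡n k≤n))
                                       (ℚP.*-comm (f (n ∸ k)) (g k))) ⟩
  sumTo n (λ k → g k * f (n ∸ k)) ∎
  where open ≡-Reasoning

*ₚ-distribˡ : ∀ h f g → (h *ₚ (f +ₚ g)) ≈ₚ ((h *ₚ f) +ₚ (h *ₚ g))
*ₚ-distribˡ h f g n = trans (sumTo-cong n (λ k → ℚP.*-distribˡ-+ (h k) (f (n ∸ k)) (g (n ∸ k))))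
                            (sumTo-+ n _ _)

*ₚ-distribʳ : ∀ h f g → ((f +ₚ g) *ₚ h) ≈ₚ ((f *ₚ h) +ₚ (g *ₚ h))
*ₚ-distribʳ h f g n = trans (sumTo-cong n (λ k → ℚP.*-distribʳ-+ (h (n ∸ k)) (f k) (g k)))
                            (sumTo-+ n _ _)

*ₚ-zeroˡ : ∀ f → (zeroP *ₚ f) ≈ₚ zeroP
*ₚ-zeroˡ f n = trans (sumTo-cong n (λ k → ℚP.*-zeroˡ (f (n ∸ k)))) (sumTo-zero n)

constP-*ₚ : ∀ a f n → (constP a *ₚ f) n ≡ a * f n
constP-*ₚ a f zero    = refl
constP-*ₚ a f (suc n) = begin
  (constP a *ₚ f) (suc n)       ≡⟨ *ₚ-suc (constP a) f n ⟩
  a * f (suc n) + (zeroP *ₚ f) n ≡⟨ cong ((a * f (suc n)) +_) (*ₚ-zeroˡ f n) ⟩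
  a * f (suc n) + 0ℚ            ≡⟨ ℚP.+-identityʳ _ ⟩
  a * f (suc n)                 ∎
  where open ≡-Reasoning

*ₚ-identityˡ : ∀ f → (oneP *ₚ f) ≈ₚ f
*ₚ-identityˡ f n = trans (constP-*ₚ 1ℚ f n) (ℚP.*-identityˡ (f n))

*ₚ-assoc : ∀ f g h → ((f *ₚ g) *ₚ h) ≈ₚ (f *ₚ (g *ₚ h))
*ₚ-assoc f g h zero    = ℚP.*-assoc (f 0) (g 0) (h 0)
*ₚ-assoc f g h (suc n) = begin
  ((f *ₚ g) *ₚ h) (suc n)
    ≡⟨ *ₚ-suc (f *ₚ g) h n ⟩
  (f 0 * g 0) * h (suc n) + sumTo n (λ k → (f *ₚ g) (suc k) * h (n ∸ k))
    ≡⟨ cong ((f 0 * g 0) * h (suc n) +_) (sumTo-cong n expand) ⟩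
  (f 0 * g 0) * h (suc n) + sumTo n (λ k → f 0 * (g (suc k) * h (n ∸ k)) + (tailₚ f *ₚ g) k * h (n ∸ k))
    ≡⟨ cong ((f 0 * g 0) * h (suc n) +_) (sumTo-+ n _ _) ⟩
  (f 0 * g 0) * h (suc n) + (sumTo n (λ k → f 0 * (g (suc k) * h (n ∸ k))) + ((tailₚ f *ₚ g) *ₚ h) n)
    ≡⟨ cong₂ (λ x y → (f 0 * g 0) * h (suc n) + (x + y)) (sumTo-*ˡ n (f 0) _) (*ₚ-assoc (tailₚ f) g h n) ⟩
  (f 0 * g 0) * h (suc n) + (f 0 * (tailₚ g *ₚ h) n + (tailₚ f *ₚ (g *ₚ h)) n)
    ≡⟨ solve 5 (λ a b c d e → (a :* b) :* c :+ (a :* d :+ e) := a :* (b :* c :+ d) :+ e) refl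
         (f 0) (g 0) (h (suc n)) ((tailₚ g *ₚ h) n) ((tailₚ f *ₚ (g *ₚ h)) n) ⟩
  f 0 * (g 0 * h (suc n) + (tailₚ g *ₚ h) n) + (tailₚ f *ₚ (g *ₚ h)) n
    ≡⟨ cong (λ x → f 0 * x + (tailₚ f *ₚ (g *ₚ h)) n) (sym (*ₚ-suc g h n)) ⟩
  f 0 * (g *ₚ h) (suc n) + (tailₚ f *ₚ (g *ₚ h)) n
    ≡⟨ sym (*ₚ-suc f (g *ₚ h) n) ⟩
  (f *ₚ (g *ₚ h)) (suc n) ∎
  where
  open ≡-Reasoning
  open ℚSolver.+-*-Solver
  expand : ∀ k → (f *ₚ g) (suc k) * h (n ∸ k) ≡ f 0 * (g (suc k) * h (n ∸ k)) + (tailₚ f *ₚ g) k * h (n ∸ k)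
  expand k = trans (cong (_* h (n ∸ k)) (*ₚ-suc f g k))
    (solve 4 (λ a b c d → (a :* b :+ c) :* d := a :* (b :* d) :+ c :* d) refl (f 0) (g (suc k)) ((tailₚ f *ₚ g) k) (h (n ∸ k)))

PS-isCommutativeRing : IsCommutativeRing _≈ₚ_ _+ₚ_ _*ₚ_ -ₚ_ zeroP oneP
PS-isCommutativeRing = record
  { isRing = record
    { +-isAbelianGroup = record
      { isGroup = record
        { isMonoid = record
          { isSemigroup = record
            { isMagma = record
              { isEquivalence = ≈ₚ-isEquivalence
              ; ∙-cong = +ₚ-cong }
            ; assoc = λ f g h n → ℚP.+-assoc (f n) (g n) (h n) }
          ; identity = (λ f n → ℚP.+-identityˡ (f n)) , (λ f n → ℚP.+-identityʳ (f n)) }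
        ; inverse = (λ f n → ℚP.+-inverseˡ (f n)) , (λ f n → ℚP.+-inverseʳ (f n))
        ; ⁻¹-cong = -ₚ-cong }
      ; comm = λ f g n → ℚP.+-comm (f n) (g n) }
    ; *-cong = *ₚ-cong
    ; *-assoc = *ₚ-assoc
    ; *-identity = *ₚ-identityˡ , (λ f n → trans (*ₚ-comm f oneP n) (*ₚ-identityˡ f n))
    ; distrib = *ₚ-distribˡ , *ₚ-distribʳ }
  ; *-comm = *ₚ-comm }
  where
  ≈ₚ-isEquivalence : IsEquivalence _≈ₚ_
  ≈ₚ-isEquivalence = record
    { refl = λ _ → refl ; sym = λ e n → sym (e n) ; trans = λ e e′ n → trans (e n) (e′ n) }

PS-commutativeRing : CommutativeRing 0ℓ 0ℓ
PS-commutativeRing = record { isCommutativeRing = PS-isCommutativeRing }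

constP-+ : ∀ a b → constP (a + b) ≈ₚ (constP a +ₚ constP b)
constP-+ a b zero    = refl
constP-+ a b (suc n) = sym (ℚP.+-identityʳ 0ℚ)

constP-* : ∀ a b → constP (a * b) ≈ₚ (constP a *ₚ constP b)
constP-* a b zero    = refl
constP-* a b (suc n) = trans (sym (ℚP.*-zeroʳ a)) (sym (constP-*ₚ a (constP b) (suc n)))

constP-neg : ∀ a → constP (- a) ≈ₚ (-ₚ constP a)
constP-neg a zero    = refl
constP-neg a (suc n) = refl

constP-zero : constP 0ℚ ≈ₚ zeroP
constP-zero zero    = refl
constP-zero (suc n) = refl

module PSSolver where
  private
    PS-almostCommutativeRing : ACR.AlmostCommutativeRing 0ℓ 0ℓ
    PS-almostCommutativeRing = ACR.fromCommutativeRing PS-commutativeRing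

    constP-morphism : ACR._-Raw-AlmostCommutative⟶_
      (CommutativeRing.rawRing ℚP.+-*-commutativeRing) PS-almostCommutativeRing
    constP-morphism = record
      { ⟦_⟧ = constP ; +-homo = constP-+ ; *-homo = constP-* ; -‿homo = constP-neg
      ; 0-homo = constP-zero ; 1-homo = λ _ → refl }

    constP-≟ : ∀ x y → Maybe (constP x ≈ₚ constP y)
    constP-≟ x y with x ℚ.≟ y
    ... | yes refl = just (λ _ → refl)
    ... | no _     = nothing

  open Algebra.Solver.Ring (CommutativeRing.rawRing ℚP.+-*-commutativeRing)
    PS-almostCommutativeRing constP-morphism constP-≟ public

module ≈ₚ-Reasoning = Relation.Binary.Reasoning.Setoid (CommutativeRing.setoid PS-commutativeRing)

θ : PS → PS
θ f n = ℕ→ℚ n * f n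

θ-cong : ∀ {f g} → f ≈ₚ g → θ f ≈ₚ θ g
θ-cong e n = cong (ℕ→ℚ n *_) (e n)

θ-+ : ∀ f g → θ (f +ₚ g) ≈ₚ (θ f +ₚ θ g)
θ-+ f g n = ℚP.*-distribˡ-+ (ℕ→ℚ n) (f n) (g n)

θ-constP : ∀ a → θ (constP a) ≈ₚ zeroP
θ-constP a zero    = ℚP.*-zeroˡ a
θ-constP a (suc n) = ℚP.*-zeroʳ (ℕ→ℚ (suc n))

θ-* : ∀ f g → θ (f *ₚ g) ≈ₚ ((θ f *ₚ g) +ₚ (f *ₚ θ g))
θ-* f g n = begin
  ℕ→ℚ n * sumTo n (λ k → f k * g (n ∸ k))
    ≡⟨ sumTo-*ˡ n (ℕ→ℚ n) _ ⟨
  sumTo n (λ k → ℕ→ℚ n * (f k * g (n ∸ k)))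
    ≡⟨ sumTo-cong≤ n leibniz ⟩
  sumTo n (λ k → (ℕ→ℚ k * f k) * g (n ∸ k) + f k * (ℕ→ℚ (n ∸ k) * g (n ∸ k)))
    ≡⟨ sumTo-+ n _ _ ⟩
  ((θ f *ₚ g) +ₚ (f *ₚ θ g)) n ∎
  where
  open ≡-Reasoning
  leibniz : ∀ k → k ≤ n → ℕ→ℚ n * (f k * g (n ∸ k)) ≡ (ℕ→ℚ k * f k) * g (n ∸ k) + f k * (ℕ→ℚ (n ∸ k) * g (n ∸ k))
  leibniz k k≤n = begin
    ℕ→ℚ n * (f k * g (n ∸ k))
      ≡⟨ cong (λ m → ℕ→ℚ m * (f k * g (n ∸ k))) (ℕP.m+[n∸m]≡n k≤n) ⟨
    ℕ→ℚ (k ℕ.+ (n ∸ k)) * (f k * g (n ∸ k))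
      ≡⟨ cong (_* (f k * g (n ∸ k))) (ℕ→ℚ-+ k (n ∸ k)) ⟩
    (ℕ→ℚ k + ℕ→ℚ (n ∸ k)) * (f k * g (n ∸ k))
      ≡⟨ solve 4 (λ a b x y → (a :+ b) :* (x :* y) := (a :* x) :* y :+ x :* (b :* y)) refl
           (ℕ→ℚ k) (ℕ→ℚ (n ∸ k)) (f k) (g (n ∸ k)) ⟩
    (ℕ→ℚ k * f k) * g (n ∸ k) + f k * (ℕ→ℚ (n ∸ k) * g (n ∸ k)) ∎
    where open ℚSolver.+-*-Solver

tP-*ₚ-suc : ∀ f n → (tP *ₚ f) (suc n) ≡ f n
tP-*ₚ-suc f n = begin
  (tP *ₚ f) (suc n)              ≡⟨ *ₚ-suc tP f n ⟩
  0ℚ * f (suc n) + (tailₚ tP *ₚ f) n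
    ≡⟨ cong₂ _+_ (ℚP.*-zeroˡ (f (suc n))) (trans (*ₚ-congʳ f tailₚ-tP n) (*ₚ-identityˡ f n)) ⟩
  0ℚ + f n                       ≡⟨ ℚP.+-identityˡ (f n) ⟩
  f n                            ∎
  where
  open ≡-Reasoning
  tailₚ-tP : tailₚ tP ≈ₚ oneP
  tailₚ-tP zero    = refl
  tailₚ-tP (suc k) = refl

tP-*ₚ-cancelˡ : ∀ {f g} → (tP *ₚ f) ≈ₚ (tP *ₚ g) → f ≈ₚ g
tP-*ₚ-cancelˡ {f} {g} e n = trans (sym (tP-*ₚ-suc f n)) (trans (e (suc n)) (tP-*ₚ-suc g n))

θ-tP : θ tP ≈ₚ tP
θ-tP zero          = refl
θ-tP (suc zero)    = refl
θ-tP (suc (suc n)) = ℚP.*-zeroʳ (ℕ→ℚ (suc (suc n)))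

expP : PS
expP = oneP +ₚ expm1

θ-expm1 : θ expm1 ≈ₚ (tP *ₚ expP)
θ-expm1 zero          = refl
θ-expm1 (suc zero)    = trans (inv!-suc 0) (sym (tP-*ₚ-suc expP 0))
θ-expm1 (suc (suc n)) = trans (inv!-suc (suc n))
  (trans (sym (ℚP.+-identityˡ _)) (sym (tP-*ₚ-suc expP (suc n))))

evalP-+ₗ : ∀ p q F → evalP (p +ₗ q) F ≈ₚ (evalP p F +ₚ evalP q F)
evalP-+ₗ []      q       F n = sym (ℚP.+-identityˡ _)
evalP-+ₗ (a ∷ p) []      F n = sym (ℚP.+-identityʳ _)
evalP-+ₗ (a ∷ p) (b ∷ q) F = begin
  constP (a + b) +ₚ (F *ₚ evalP (p +ₗ q) F)
    ≈⟨ +ₚ-cong (constP-+ a b) (*ₚ-congˡ F (evalP-+ₗ p q F)) ⟩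
  (constP a +ₚ constP b) +ₚ (F *ₚ (evalP p F +ₚ evalP q F))
    ≈⟨ solve 5 (λ a b f x y → (a :+ b) :+ f :* (x :+ y) := (a :+ f :* x) :+ (b :+ f :* y)) (λ _ → refl)
         (constP a) (constP b) F (evalP p F) (evalP q F) ⟩
  (constP a +ₚ (F *ₚ evalP p F)) +ₚ (constP b +ₚ (F *ₚ evalP q F)) ∎
  where open ≈ₚ-Reasoning
        open PSSolver

evalP-onePlusX· : ∀ p F → evalP (onePlusX· p) F ≈ₚ ((oneP +ₚ F) *ₚ evalP p F)
evalP-onePlusX· p F = begin
  evalP (p +ₗ (0ℚ ∷ p)) F       ≈⟨ evalP-+ₗ p (0ℚ ∷ p) F ⟩
  P +ₚ (constP 0ℚ +ₚ (F *ₚ P))  ≈⟨ solve 2 (λ x f → x :+ (con 0ℚ :+ f :* x) := (con 1ℚ :+ f) :* x) (λ _ → refl) P F ⟩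
  (oneP +ₚ F) *ₚ P              ∎
  where open ≈ₚ-Reasoning
        open PSSolver
        P = evalP p F

θ-zeroP : θ zeroP ≈ₚ zeroP
θ-zeroP n = ℚP.*-zeroʳ (ℕ→ℚ n)

θ-evalP-∷ : ∀ a p F →
  θ (constP a +ₚ (F *ₚ evalP p F)) ≈ₚ ((θ F *ₚ evalP p F) +ₚ (F *ₚ θ (evalP p F)))
θ-evalP-∷ a p F = begin
  θ (constP a +ₚ (F *ₚ P))                 ≈⟨ θ-+ (constP a) (F *ₚ P) ⟩
  θ (constP a) +ₚ θ (F *ₚ P)               ≈⟨ +ₚ-cong (θ-constP a) (θ-* F P) ⟩
  zeroP +ₚ ((θ F *ₚ P) +ₚ (F *ₚ θ P))      ≈⟨ (λ n → ℚP.+-identityˡ _) ⟩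
  (θ F *ₚ P) +ₚ (F *ₚ θ P)                 ∎
  where open ≈ₚ-Reasoning
        P = evalP p F

-- shiftOp c realises p ↦ c p − X p′, and θ (p(F)) = θF · p′(F).
evalP-shiftOp : ∀ c p F →
  (θ F *ₚ evalP (shiftOp c p) F) ≈ₚ
  (((constP c *ₚ θ F) *ₚ evalP p F) +ₚ (-ₚ (F *ₚ θ (evalP p F))))
evalP-shiftOp c [] F = begin
  D *ₚ zeroP
    ≈⟨ *ₚ-congˡ D constP-zero ⟨
  D *ₚ constP 0ℚ
    ≈⟨ solve 3 (λ c d f → d :* con 0ℚ := (c :* d) :* con 0ℚ :+ :- (f :* con 0ℚ)) (λ _ → refl) K D F ⟩
  ((K *ₚ D) *ₚ constP 0ℚ) +ₚ (-ₚ (F *ₚ constP 0ℚ))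
    ≈⟨ +ₚ-cong (*ₚ-congˡ (K *ₚ D) constP-zero) (-ₚ-cong (*ₚ-congˡ F (λ n → trans (constP-zero n) (sym (θ-zeroP n))))) ⟩
  ((K *ₚ D) *ₚ zeroP) +ₚ (-ₚ (F *ₚ θ zeroP)) ∎
  where open ≈ₚ-Reasoning
        open PSSolver
        K = constP c
        D = θ F
evalP-shiftOp c (a ∷ p) F = begin
  D *ₚ (constP (c * a) +ₚ (F *ₚ S))
    ≈⟨ *ₚ-congˡ D (+ₚ-congʳ (F *ₚ S) (constP-* c a)) ⟩
  D *ₚ ((K *ₚ A) +ₚ (F *ₚ S))
    ≈⟨ solve 5 (λ d c a f s → d :* (c :* a :+ f :* s) := (c :* d) :* a :+ f :* (d :* s)) (λ _ → refl) D K A F S ⟩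
  ((K *ₚ D) *ₚ A) +ₚ (F *ₚ (D *ₚ S))
    ≈⟨ +ₚ-congˡ ((K *ₚ D) *ₚ A) (*ₚ-congˡ F (evalP-shiftOp (c - 1ℚ) p F)) ⟩
  ((K *ₚ D) *ₚ A) +ₚ (F *ₚ (((constP (c - 1ℚ) *ₚ D) *ₚ P) +ₚ (-ₚ (F *ₚ θ P))))
    ≈⟨ +ₚ-congˡ ((K *ₚ D) *ₚ A) (*ₚ-congˡ F (+ₚ-congʳ (-ₚ (F *ₚ θ P)) (*ₚ-congʳ P (*ₚ-congʳ D c-1≈)))) ⟩
  ((K *ₚ D) *ₚ A) +ₚ (F *ₚ ((((K +ₚ (-ₚ oneP)) *ₚ D) *ₚ P) +ₚ (-ₚ (F *ₚ θ P))))
    ≈⟨ solve 6 (λ c d a f x y →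
         (c :* d) :* a :+ f :* (((c :+ :- con 1ℚ) :* d) :* x :+ :- (f :* y))
         := (c :* d) :* (a :+ f :* x) :+ :- (f :* (d :* x :+ f :* y)))
         (λ _ → refl) K D A F P (θ P) ⟩
  ((K *ₚ D) *ₚ (A +ₚ (F *ₚ P))) +ₚ (-ₚ (F *ₚ ((D *ₚ P) +ₚ (F *ₚ θ P))))
    ≈⟨ +ₚ-congˡ ((K *ₚ D) *ₚ (A +ₚ (F *ₚ P))) (-ₚ-cong (*ₚ-congˡ F (θ-evalP-∷ a p F))) ⟨
  ((K *ₚ D) *ₚ (A +ₚ (F *ₚ P))) +ₚ (-ₚ (F *ₚ θ (A +ₚ (F *ₚ P)))) ∎
  where
  open ≈ₚ-Reasoning
  open PSSolver
  K = constP c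
  A = constP a
  D = θ F
  P = evalP p F
  S = evalP (shiftOp (c - 1ℚ) p) F
  c-1≈ : constP (c - 1ℚ) ≈ₚ (K +ₚ (-ₚ oneP))
  c-1≈ n = trans (constP-+ c (- 1ℚ) n) (+ₚ-congˡ K (constP-neg 1ℚ) n)

θ-^ : ∀ f j → θ (f ^ₚ suc j) ≈ₚ (constP (ℕ→ℚ (suc j)) *ₚ ((f ^ₚ j) *ₚ θ f))
θ-^ f zero = begin
  θ (f *ₚ oneP)                    ≈⟨ θ-* f oneP ⟩
  (θ f *ₚ oneP) +ₚ (f *ₚ θ oneP)   ≈⟨ +ₚ-congˡ (θ f *ₚ oneP) (*ₚ-congˡ f θ-oneP) ⟩
  (θ f *ₚ oneP) +ₚ (f *ₚ constP 0ℚ)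
    ≈⟨ solve 2 (λ a b → a :* con 1ℚ :+ b :* con 0ℚ := con 1ℚ :* (con 1ℚ :* a)) (λ _ → refl) (θ f) f ⟩
  oneP *ₚ (oneP *ₚ θ f)            ∎
  where
  open ≈ₚ-Reasoning
  open PSSolver
  θ-oneP : θ oneP ≈ₚ constP 0ℚ
  θ-oneP n = trans (θ-constP 1ℚ n) (sym (constP-zero n))
θ-^ f (suc j) = begin
  θ (f *ₚ Q)                                   ≈⟨ θ-* f Q ⟩
  (θ f *ₚ Q) +ₚ (f *ₚ θ Q)                     ≈⟨ +ₚ-congˡ (θ f *ₚ Q) (*ₚ-congˡ f (θ-^ f j)) ⟩
  (θ f *ₚ Q) +ₚ (f *ₚ (K *ₚ (R *ₚ θ f)))
    ≈⟨ solve 4 (λ a b r c → a :* (b :* r) :+ b :* (c :* (r :* a)) := (con 1ℚ :+ c) :* ((b :* r) :* a))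
         (λ _ → refl) (θ f) f R K ⟩
  (oneP +ₚ K) *ₚ (Q *ₚ θ f)                    ≈⟨ *ₚ-congʳ (Q *ₚ θ f) 1+K≈ ⟩
  constP (ℕ→ℚ (suc (suc j))) *ₚ (Q *ₚ θ f)     ∎
  where
  open ≈ₚ-Reasoning
  open PSSolver
  R = f ^ₚ j
  Q = f *ₚ R
  K = constP (ℕ→ℚ (suc j))
  1+K≈ : (oneP +ₚ K) ≈ₚ constP (ℕ→ℚ (suc (suc j)))
  1+K≈ n = sym (trans (cong (λ x → constP x n) (ℕ→ℚ-suc (suc j))) (constP-+ 1ℚ (ℕ→ℚ (suc j)) n))

[k+1]*nC[k+1]+k*nCk≡n*nCk : ∀ n k → suc k ℕ.* (n C suc k) ℕ.+ k ℕ.* (n C k) ≡ n ℕ.* (n C k)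
[k+1]*nC[k+1]+k*nCk≡n*nCk zero    zero    = refl
[k+1]*nC[k+1]+k*nCk≡n*nCk zero    (suc k) = cong₂ ℕ._+_ (ℕP.*-zeroʳ (suc (suc k))) (ℕP.*-zeroʳ (suc k))
[k+1]*nC[k+1]+k*nCk≡n*nCk (suc n) zero    = begin
  1 ℕ.* (suc n C 1) ℕ.+ 0  ≡⟨ ℕP.+-identityʳ _ ⟩
  1 ℕ.* (suc n C 1)        ≡⟨ ℕP.*-identityˡ _ ⟩
  suc n C 1                ≡⟨ nC1≡n (suc n) ⟩
  suc n                    ≡⟨ ℕP.*-identityʳ (suc n) ⟨
  suc n ℕ.* 1              ∎
  where open ≡-Reasoning
[k+1]*nC[k+1]+k*nCk≡n*nCk (suc n) (suc k) = begin
  suc (suc k) ℕ.* (suc n C suc (suc k)) ℕ.+ suc k ℕ.* (suc n C suc k)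
    ≡⟨ cong₂ (λ x y → suc (suc k) ℕ.* x ℕ.+ suc k ℕ.* y)
         (nCk+nC[k+1]≡[n+1]C[k+1] n (suc k)) (nCk+nC[k+1]≡[n+1]C[k+1] n k) ⟨
  suc (suc k) ℕ.* (b ℕ.+ c) ℕ.+ suc k ℕ.* (a ℕ.+ b)
    ≡⟨ solve 4 (λ k a b c → (con 2 :+ k) :* (b :+ c) :+ (con 1 :+ k) :* (a :+ b)
                         := ((con 2 :+ k) :* c :+ (con 1 :+ k) :* b) :+ ((con 1 :+ k) :* b :+ k :* a) :+ a :+ b)
         refl k a b c ⟩
  (suc (suc k) ℕ.* c ℕ.+ suc k ℕ.* b) ℕ.+ (suc k ℕ.* b ℕ.+ k ℕ.* a) ℕ.+ a ℕ.+ b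
    ≡⟨ cong₂ (λ x y → x ℕ.+ y ℕ.+ a ℕ.+ b) ([k+1]*nC[k+1]+k*nCk≡n*nCk n (suc k)) ([k+1]*nC[k+1]+k*nCk≡n*nCk n k) ⟩
  n ℕ.* b ℕ.+ n ℕ.* a ℕ.+ a ℕ.+ b
    ≡⟨ solve 3 (λ n a b → n :* b :+ n :* a :+ a :+ b := (con 1 :+ n) :* (a :+ b)) refl n a b ⟩
  suc n ℕ.* (a ℕ.+ b)
    ≡⟨ cong (suc n ℕ.*_) (nCk+nC[k+1]≡[n+1]C[k+1] n k) ⟩
  suc n ℕ.* (suc n C suc k) ∎
  where
  open ≡-Reasoning
  open ℕSolver.+-*-Solver
  a = n C k
  b = n C suc k
  c = n C suc (suc k)

absorption : ∀ n k → ℕ→ℚ (suc k) * ℕ→ℚ (n C suc k) ≡ (ℕ→ℚ n - ℕ→ℚ k) * ℕ→ℚ (n C k)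
absorption n k = begin
  K * b                ≡⟨ solve 4 (λ K b J a → K :* b := (K :* b :+ J :* a) :+ :- (J :* a)) refl K b J a ⟩
  (K * b + J * a) - J * a ≡⟨ cong (_- J * a) cast ⟩
  N * a - J * a        ≡⟨ solve 3 (λ N J a → N :* a :+ :- (J :* a) := (N :+ :- J) :* a) refl N J a ⟩
  (N - J) * a          ∎
  where
  open ≡-Reasoning
  open ℚSolver.+-*-Solver
  K = ℕ→ℚ (suc k)
  J = ℕ→ℚ k
  N = ℕ→ℚ n
  a = ℕ→ℚ (n C k)
  b = ℕ→ℚ (n C suc k)
  cast : K * b + J * a ≡ N * a
  cast = begin
    K * b + J * a
      ≡⟨ cong₂ _+_ (ℕ→ℚ-* (suc k) (n C suc k)) (ℕ→ℚ-* k (n C k)) ⟨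
    ℕ→ℚ (suc k ℕ.* (n C suc k)) + ℕ→ℚ (k ℕ.* (n C k))
      ≡⟨ ℕ→ℚ-+ (suc k ℕ.* (n C suc k)) (k ℕ.* (n C k)) ⟨
    ℕ→ℚ (suc k ℕ.* (n C suc k) ℕ.+ k ℕ.* (n C k))
      ≡⟨ cong ℕ→ℚ ([k+1]*nC[k+1]+k*nCk≡n*nCk n k) ⟩
    ℕ→ℚ (n ℕ.* (n C k))
      ≡⟨ ℕ→ℚ-* n (n C k) ⟩
    N * a ∎

-- ∏_{i=1}^{j} (i − n): the eigenvalue of ∏_{i=1}^{j} (i − θ) on tⁿ.
eigenvalue : ℕ → ℕ → ℚ
eigenvalue zero    n = 1ℚ
eigenvalue (suc j) n = (ℕ→ℚ (suc j) - ℕ→ℚ n) * eigenvalue j n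

eigenvalue-zero : ∀ j → eigenvalue j 0 ≡ ℕ→ℚ (j !)
eigenvalue-zero zero    = refl
eigenvalue-zero (suc j) = begin
  (ℕ→ℚ (suc j) - 0ℚ) * eigenvalue j 0 ≡⟨ cong₂ _*_ (ℚP.+-identityʳ (ℕ→ℚ (suc j))) (eigenvalue-zero j) ⟩
  ℕ→ℚ (suc j) * ℕ→ℚ (j !)            ≡⟨ ℕ→ℚ-* (suc j) (j !) ⟨
  ℕ→ℚ (suc j !)                       ∎
  where open ≡-Reasoning

eigenvalue-suc : ∀ j m → eigenvalue j (suc m) ≡ ℕ→ℚ (j !) * neg1^ j * ℕ→ℚ (m C j)
eigenvalue-suc zero    m = refl
eigenvalue-suc (suc j) m = begin
  (K - ℕ→ℚ (suc m)) * eigenvalue j (suc m)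
    ≡⟨ cong₂ _*_ K-[1+m] (eigenvalue-suc j m) ⟩
  - (M - J) * (f * s * a)
    ≡⟨ solve 5 (λ M J f s a → :- (M :+ :- J) :* (f :* s :* a) := :- (f :* s) :* ((M :+ :- J) :* a)) refl M J f s a ⟩
  - (f * s) * ((M - J) * a)
    ≡⟨ cong (- (f * s) *_) (absorption m j) ⟨
  - (f * s) * (K * b)
    ≡⟨ solve 4 (λ K f s b → :- (f :* s) :* (K :* b) := (K :* f) :* (:- s) :* b) refl K f s b ⟩
  (K * f) * - s * b
    ≡⟨ cong (λ x → x * - s * b) (ℕ→ℚ-* (suc j) (j !)) ⟨
  ℕ→ℚ (suc j !) * neg1^ (suc j) * b ∎
  where
  open ≡-Reasoning
  open ℚSolver.+-*-Solver
  K = ℕ→ℚ (suc j)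
  J = ℕ→ℚ j
  M = ℕ→ℚ m
  f = ℕ→ℚ (j !)
  s = neg1^ j
  a = ℕ→ℚ (m C j)
  b = ℕ→ℚ (m C suc j)
  K-[1+m] : K - ℕ→ℚ (suc m) ≡ - (M - J)
  K-[1+m] = begin
    K - ℕ→ℚ (suc m)           ≡⟨ cong₂ _-_ (ℕ→ℚ-suc j) (ℕ→ℚ-suc m) ⟩
    (1ℚ + J) - (1ℚ + M)       ≡⟨ solve 2 (λ J M → (con 1ℚ :+ J) :+ :- (con 1ℚ :+ M) := :- (M :+ :- J)) refl J M ⟩
    - (M - J)                 ∎

module _ (B : ℕ → ℚ) (isBernoulli : IsBernoulli B) where

  private
    β = egf B
    F = expm1

  bernoulli-ode : (expP *ₚ (β *ₚ β)) ≈ₚ (β +ₚ (-ₚ θ β))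
  bernoulli-ode = tP-*ₚ-cancelˡ (begin
    tP *ₚ (expP *ₚ (β *ₚ β))
      ≈⟨ solve 3 (λ t e b → t :* (e :* (b :* b)) := b :* (b :* (t :* e))) (λ _ → refl) tP expP β ⟩
    β *ₚ (β *ₚ (tP *ₚ expP))
      ≈⟨ *ₚ-congˡ β β*θF ⟩
    β *ₚ (tP +ₚ (-ₚ (θ β *ₚ F)))
      ≈⟨ solve 4 (λ b t a f → b :* (t :+ :- (a :* f)) := b :* t :+ :- (a :* (b :* f))) (λ _ → refl) β tP (θ β) F ⟩
    (β *ₚ tP) +ₚ (-ₚ (θ β *ₚ (β *ₚ F)))
      ≈⟨ +ₚ-congˡ (β *ₚ tP) (-ₚ-cong (*ₚ-congˡ (θ β) isBernoulli)) ⟩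
    (β *ₚ tP) +ₚ (-ₚ (θ β *ₚ tP))
      ≈⟨ solve 3 (λ b t a → b :* t :+ :- (a :* t) := t :* (b :+ :- a)) (λ _ → refl) β tP (θ β) ⟩
    tP *ₚ (β +ₚ (-ₚ θ β)) ∎)
    where
    open ≈ₚ-Reasoning
    open PSSolver
    β*θF : (β *ₚ (tP *ₚ expP)) ≈ₚ (tP +ₚ (-ₚ (θ β *ₚ F)))
    β*θF = begin
      β *ₚ (tP *ₚ expP)                              ≈⟨ *ₚ-congˡ β θ-expm1 ⟨
      β *ₚ θ F
        ≈⟨ solve 4 (λ a f b d → b :* d := (a :* f :+ b :* d) :+ :- (a :* f)) (λ _ → refl) (θ β) F β (θ F) ⟩
      ((θ β *ₚ F) +ₚ (β *ₚ θ F)) +ₚ (-ₚ (θ β *ₚ F))  ≈⟨ +ₚ-congʳ (-ₚ (θ β *ₚ F)) (θ-* β F) ⟨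
      θ (β *ₚ F) +ₚ (-ₚ (θ β *ₚ F))                  ≈⟨ +ₚ-congʳ (-ₚ (θ β *ₚ F)) (θ-cong isBernoulli) ⟩
      θ tP +ₚ (-ₚ (θ β *ₚ F))                        ≈⟨ +ₚ-congʳ (-ₚ (θ β *ₚ F)) θ-tP ⟩
      tP +ₚ (-ₚ (θ β *ₚ F))                          ∎

  lhs-zero : lhs B 0 ≈ₚ β
  lhs-zero = begin
    (β *ₚ oneP) *ₚ (oneP +ₚ (F *ₚ zeroP))        ≈⟨ *ₚ-congˡ (β *ₚ oneP) (+ₚ-congˡ oneP (*ₚ-congˡ F constP-zero)) ⟨
    (β *ₚ oneP) *ₚ (oneP +ₚ (F *ₚ constP 0ℚ))
      ≈⟨ solve 2 (λ b f → (b :* con 1ℚ) :* (con 1ℚ :+ f :* con 0ℚ) := b) (λ _ → refl) β F ⟩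
    β                                            ∎
    where open ≈ₚ-Reasoning
          open PSSolver

  -- Multiplying by t brings in θF = t eᵗ and βF = t; t is cancelled at the end.
  lhs-suc : ∀ j → lhs B (suc j) ≈ₚ ((constP (ℕ→ℚ (suc j)) *ₚ lhs B j) +ₚ (-ₚ θ (lhs B j)))
  lhs-suc j = tP-*ₚ-cancelˡ (begin
    tP *ₚ ((β *ₚ Q) *ₚ evalP (onePlusX· (thetaOp (suc j) (h j))) F)
      ≈⟨ *ₚ-congˡ tP (*ₚ-congˡ (β *ₚ Q) (evalP-onePlusX· (thetaOp (suc j) (h j)) F)) ⟩
    tP *ₚ ((β *ₚ Q) *ₚ (expP *ₚ S))
      ≈⟨ solve 4 (λ t q e s → t :* (q :* (e :* s)) := q :* ((t :* e) :* s)) (λ _ → refl) tP (β *ₚ Q) expP S ⟩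
    (β *ₚ Q) *ₚ ((tP *ₚ expP) *ₚ S)
      ≈⟨ *ₚ-congˡ (β *ₚ Q) (*ₚ-congʳ S θ-expm1) ⟨
    (β *ₚ Q) *ₚ (θ F *ₚ S)
      ≈⟨ *ₚ-congˡ (β *ₚ Q) (evalP-shiftOp (ℕ→ℚ (suc j)) (h j) F) ⟩
    (β *ₚ Q) *ₚ (((K *ₚ θ F) *ₚ H) +ₚ (-ₚ (F *ₚ θ H)))
      ≈⟨ *ₚ-congˡ (β *ₚ Q) (+ₚ-congʳ (-ₚ (F *ₚ θ H)) (*ₚ-congʳ H (*ₚ-congˡ K θ-expm1))) ⟩
    (β *ₚ Q) *ₚ (((K *ₚ (tP *ₚ expP)) *ₚ H) +ₚ (-ₚ (F *ₚ θ H)))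
      ≈⟨ solve 8 (λ b r k t e hh f y →
           (b :* (b :* r)) :* ((k :* (t :* e)) :* hh :+ :- (f :* y))
           := (((k :* t) :* r) :* hh) :* (e :* (b :* b)) :+ :- ((b :* f) :* ((b :* r) :* y)))
           (λ _ → refl) β R K tP expP H F (θ H) ⟩
    (X *ₚ (expP *ₚ (β *ₚ β))) +ₚ (-ₚ ((β *ₚ F) *ₚ (Q *ₚ θ H)))
      ≈⟨ +ₚ-cong (*ₚ-congˡ X bernoulli-ode) (-ₚ-cong (*ₚ-congʳ (Q *ₚ θ H) isBernoulli)) ⟩
    (X *ₚ (β +ₚ (-ₚ θ β))) +ₚ (-ₚ (tP *ₚ (Q *ₚ θ H)))
      ≈⟨ solve 7 (λ k t r hh b a y →
           (((k :* t) :* r) :* hh) :* (b :+ :- a) :+ :- (t :* ((b :* r) :* y))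
           := t :* (k :* ((b :* r) :* hh) :+ :- ((k :* (r :* a)) :* hh :+ (b :* r) :* y)))
           (λ _ → refl) K tP R H β (θ β) (θ H) ⟩
    tP *ₚ ((K *ₚ (Q *ₚ H)) +ₚ (-ₚ (((K *ₚ (R *ₚ θ β)) *ₚ H) +ₚ (Q *ₚ θ H))))
      ≈⟨ *ₚ-congˡ tP (+ₚ-congˡ (K *ₚ (Q *ₚ H)) (-ₚ-cong θ[QH])) ⟨
    tP *ₚ ((K *ₚ (Q *ₚ H)) +ₚ (-ₚ θ (Q *ₚ H))) ∎)
    where
    open ≈ₚ-Reasoning
    open PSSolver
    K = constP (ℕ→ℚ (suc j))
    R = β ^ₚ j
    Q = β *ₚ R
    H = evalP (h j) F
    S = evalP (thetaOp (suc j) (h j)) F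
    X = ((K *ₚ tP) *ₚ R) *ₚ H
    θ[QH] : θ (Q *ₚ H) ≈ₚ (((K *ₚ (R *ₚ θ β)) *ₚ H) +ₚ (Q *ₚ θ H))
    θ[QH] n = trans (θ-* Q H n) (+ₚ-congʳ (Q *ₚ θ H) (*ₚ-congʳ H (θ-^ β j)) n)

  egf-zero : β 0 ≡ 1ℚ
  egf-zero = trans (solve 2 (λ x y → x := x :* con 1ℚ :+ y :* con 0ℚ) refl (β 0) (β 1)) (isBernoulli 1)
    where open ℚSolver.+-*-Solver

  lhs-suc-coeff : ∀ j n → lhs B (suc j) n ≡ (ℕ→ℚ (suc j) - ℕ→ℚ n) * lhs B j n
  lhs-suc-coeff j n = begin
    lhs B (suc j) n
      ≡⟨ lhs-suc j n ⟩
    (constP c *ₚ lhs B j) n + - (ℕ→ℚ n * lhs B j n)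
      ≡⟨ cong (_+ - (ℕ→ℚ n * lhs B j n)) (constP-*ₚ c (lhs B j) n) ⟩
    c * lhs B j n + - (ℕ→ℚ n * lhs B j n)
      ≡⟨ solve 3 (λ c m x → c :* x :+ :- (m :* x) := (c :+ :- m) :* x) refl c (ℕ→ℚ n) (lhs B j n) ⟩
    (c - ℕ→ℚ n) * lhs B j n ∎
    where open ≡-Reasoning
          open ℚSolver.+-*-Solver
          c = ℕ→ℚ (suc j)

  lhs-coeff : ∀ j n → lhs B j n ≡ eigenvalue j n * β n
  lhs-coeff zero    n = trans (lhs-zero n) (sym (ℚP.*-identityˡ (β n)))
  lhs-coeff (suc j) n = begin
    lhs B (suc j) n                                 ≡⟨ lhs-suc-coeff j n ⟩
    (ℕ→ℚ (suc j) - ℕ→ℚ n) * lhs B j n               ≡⟨ cong ((ℕ→ℚ (suc j) - ℕ→ℚ n) *_) (lhs-coeff j n) ⟩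
    (ℕ→ℚ (suc j) - ℕ→ℚ n) * (eigenvalue j n * β n)  ≡⟨ ℚP.*-assoc (ℕ→ℚ (suc j) - ℕ→ℚ n) (eigenvalue j n) (β n) ⟨
    eigenvalue (suc j) n * β n                      ∎
    where open ≡-Reasoning

rhs-zero : ∀ B j → rhs B j 0 ≡ ℕ→ℚ (j !)
rhs-zero B j with j <? 0
... | no _ = solve 2 (λ f s → f :* (con 1ℚ :+ s :* con 0ℚ) := f) refl (ℕ→ℚ (j !)) (neg1^ j)
  where open ℚSolver.+-*-Solver

rhs-suc : ∀ B j m → rhs B j (suc m) ≡ ℕ→ℚ (j !) * neg1^ j * ℕ→ℚ (m C j) * egf B (suc m)
rhs-suc B j m with j <? suc m
... | yes _ = solve 5 (λ f s c b i → f :* (con 0ℚ :+ s :* (c :* b :* i)) := f :* s :* c :* (b :* i)) refl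
                (ℕ→ℚ (j !)) (neg1^ j) (ℕ→ℚ (m C j)) (B (suc m)) (inv! (suc m))
  where open ℚSolver.+-*-Solver
... | no j≮1+m rewrite k>n⇒nCk≡0 (ℕP.≮⇒≥ j≮1+m) =
  solve 3 (λ f s e → f :* (con 0ℚ :+ s :* con 0ℚ) := f :* s :* con 0ℚ :* e) refl (ℕ→ℚ (j !)) (neg1^ j) (egf B (suc m))
  where open ℚSolver.+-*-Solver

mainTheorem3 : (B : ℕ → ℚ) → IsBernoulli B →
    (j : ℕ) → lhs B j ≈ₚ rhs B j
mainTheorem3 B isBernoulli j zero = begin
  lhs B j 0                   ≡⟨ lhs-coeff B isBernoulli j 0 ⟩
  eigenvalue j 0 * egf B 0    ≡⟨ cong₂ _*_ (eigenvalue-zero j) (egf-zero B isBernoulli) ⟩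
  ℕ→ℚ (j !) * 1ℚ              ≡⟨ ℚP.*-identityʳ (ℕ→ℚ (j !)) ⟩
  ℕ→ℚ (j !)                   ≡⟨ rhs-zero B j ⟨
  rhs B j 0                   ∎
  where open ≡-Reasoning
mainTheorem3 B isBernoulli j (suc m) = begin
  lhs B j (suc m)                         ≡⟨ lhs-coeff B isBernoulli j (suc m) ⟩
  eigenvalue j (suc m) * egf B (suc m)    ≡⟨ cong (_* egf B (suc m)) (eigenvalue-suc j m) ⟩
  ℕ→ℚ (j !) * neg1^ j * ℕ→ℚ (m C j) * egf B (suc m) ≡⟨ rhs-suc B j m ⟨
  rhs B j (suc m)                         ∎
  where open ≡-Reasoning
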